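{- Let $G=(V,E)$ be a finite simple graph and let $u,v\in V$ be vertices with $N(u)\setminus\{v\}\neq N(v)\setminus\{u\}$. Then for every finite alphabet $\Sigma$, every symmetric decoder $\mathcal{D}\subseteq\Sigma^2$ and every word $w\in\Sigma^{|V|}$ for which there is a graph isomorphism $f\colon V\to V(G(\mathcal{D},w))$, we have $w_{f(u)}\neq w_{f(v)}$.
   Context: $N(x)$ denotes the open neighborhood of $x$. A decoder $\mathcal{D}\subseteq\Sigma^2$ is symmetric if $ab\in\mathcal{D}$ iff $ba\in\mathcal{D}$ for all $a,b\in\Sigma$. For a word $w=w_1\cdots w_n$, the letter graph $G(\mathcal{D},w)$ has vertex set $\{1,\dots,n\}$ and edge set $\{\{i,j\}\mid 1\le i<j\le n,\ w_iw_j\in\mathcal{D}\}$. -}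

module Defs where

open import Level using (Level; _⊔_; suc; 0ℓ)
open import Data.Nat using (ℕ)
open import Data.Fin using (Fin; _<_)
open import Data.Product using (_×_)
open import Data.Sum using (_⊎_)
open import Relation.Nullary using (¬_)
open import Relation.Binary.PropositionalEquality using (_≡_; _≢_)
open import Function.Bundles using (_⇔_)
import Function.Definitions

record Graph (n : ℕ) : Set₁ where
  field
    Adj   : Fin n → Fin n → Set
    sym   : ∀ {x y} → Adj x y → Adj y x
    irrefl : ∀ {x} → ¬ Adj x x
open Graph public

N : ∀ {n} → Graph n → Fin n → Fin n → Set
N G x y = Adj G x y

NeighDiffer : ∀ {n} → Graph n → Fin n → Fin n → Set
NeighDiffer G u v =
  ¬ (∀ x → (N G u x × x ≢ v) ⇔ (N G v x × x ≢ u))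

Decoder : ℕ → Set₁
Decoder k = Fin k → Fin k → Set

Symmetric : ∀ {k} → Decoder k → Set
Symmetric {k} D = ∀ (a b : Fin k) → D a b ⇔ D b a

-- A word of length n over Σ = Fin k (positions indexed by Fin n, i.e. 1..n shifted).
Word : ℕ → ℕ → Set
Word k n = Fin n → Fin k

LetterAdj : ∀ {k n} → Decoder k → Word k n → Fin n → Fin n → Set
LetterAdj D w i j = (i < j × D (w i) (w j)) ⊎ (j < i × D (w j) (w i))

record IsIsoToLetterGraph {k n} (G : Graph n) (D : Decoder k) (w : Word k n)
                          (f : Fin n → Fin n) : Set where
  field
    bijective : Function.Definitions.Bijective _≡_ _≡_ f
    preserves : ∀ x y → Adj G x y ⇔ LetterAdj D w (f x) (f y)

module Submission where

open import Defs hiding (sym)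
open import Data.Nat using (ℕ)
open import Data.Fin using (Fin)
open import Data.Fin.Properties using (<-cmp)
open import Data.Product using (_×_; _,_; proj₁)
open import Data.Sum using (inj₁; inj₂)
open import Data.Empty using (⊥-elim)
open import Relation.Binary using (tri<; tri≈; tri>)
open import Relation.Binary.PropositionalEquality
  using (_≡_; _≢_; refl; sym; subst)
open import Function.Bundles using (mk⇔; Equivalence)

-- Adjacency in a letter graph depends only on the letters, so positions carrying the
-- same letter have the same neighbours; u and v must therefore get different letters.

module _ {k n} (D : Decoder k) (symD : Symmetric D) (w : Word k n) where

  letterAdj⇒decoder : ∀ {i j} → LetterAdj D w i j → D (w i) (w j)
  letterAdj⇒decoder (inj₁ (_ , d)) = d
  letterAdj⇒decoder {i} {j} (inj₂ (_ , d)) = Equivalence.to (symD (w j) (w i)) d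

  decoder⇒letterAdj : ∀ {i j} → i ≢ j → D (w i) (w j) → LetterAdj D w i j
  decoder⇒letterAdj {i} {j} i≢j d with <-cmp i j
  ... | tri< i<j _ _ = inj₁ (i<j , d)
  ... | tri≈ _ i≡j _ = ⊥-elim (i≢j i≡j)
  ... | tri> _ _ j<i = inj₂ (j<i , Equivalence.to (symD (w i) (w j)) d)

  letterAdj-sameLetter : ∀ {i j m} → w i ≡ w j → j ≢ m →
                         LetterAdj D w i m → LetterAdj D w j m
  letterAdj-sameLetter {m = m} wi≡wj j≢m adj =
    decoder⇒letterAdj j≢m (subst (λ a → D a (w m)) wi≡wj (letterAdj⇒decoder adj))

module _ {k n} {G : Graph n} {D : Decoder k} {w : Word k n} {f : Fin n → Fin n}
         (symD : Symmetric D) (iso : IsIsoToLetterGraph G D w f) where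

  open IsIsoToLetterGraph iso

  neighbour-sameLetter : ∀ {a b} → w (f a) ≡ w (f b) →
                         ∀ x → N G a x × x ≢ b → N G b x × x ≢ a
  neighbour-sameLetter {a} {b} same x (ax , x≢b) =
    Equivalence.from (preserves b x)
      (letterAdj-sameLetter D symD w same fb≢fx (Equivalence.to (preserves a x) ax))
    , λ { refl → irrefl G ax }
    where
    fb≢fx : f b ≢ f x
    fb≢fx fb≡fx = x≢b (sym (proj₁ bijective fb≡fx))

lemma9 : ∀ {n} (G : Graph n) (u v : Fin n) → NeighDiffer G u v →
         ∀ (k : ℕ) (D : Decoder k) → Symmetric D → (w : Word k n) →
         (f : Fin n → Fin n) → IsIsoToLetterGraph G D w f →
         w (f u) ≢ w (f v)
lemma9 G u v differ k D symD w f iso same =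
  differ λ x → mk⇔ (neighbour-sameLetter symD iso same x)
                   (neighbour-sameLetter symD iso (sym same) x)
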